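{- Let $m\ge 2$, $s$, $\theta$, $n$, $r$ be positive integers. If $K_m\times K_n$ is $r$-equitably $k$-colorable for some positive integer $k<\min\big\{n-r\big\lfloor\frac{n}{m+r}\big\rfloor,\ m\big\lceil\frac{n}{m+r}\big\rceil\big\}$, then $K_{m(n)}$ is also $r$-equitably $k$-colorable.
   Context: All graphs are finite, simple, undirected. For a positive integer $k$, a (proper) $k$-coloring of a graph $G$ is a map $f:V(G)\to\{1,\dots,k\}$ with $f(x)\ne f(y)$ whenever $xy\in E(G)$; its color classes are the sets $f^{ -1}(i)$, $i=1,\dots,k$. For a positive integer $r$, an $r$-equitable $k$-coloring is a $k$-coloring in which any two color classes differ in size by at most $r$; $G$ is $r$-equitably $k$-colorable if it has one. The Kronecker product $G\times H$ has vertex set $V(G)\times V(H)$, with $(x,y)(x',y')$ an edge iff $xx'\in E(G)$ and $yy'\in E(H)$. $K_m$ is the complete graph on $m$ vertices, and $K_{m(n)}$ denotes the complete $m$-partite graph with $n$ vertices in each part. -}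

module Defs where

open import Data.Nat using (ℕ; zero; suc; _+_; _*_; _∸_; _≤_; _<_; _⊓_; _/_; NonZero)
open import Data.Fin using (Fin)
open import Data.Fin.Properties using (_≟_)
open import Data.Product using (Σ; _×_; _,_; proj₁; proj₂)
open import Data.List using (List; length; filter; cartesianProduct)
open import Data.List using () renaming (allFin to allFinL)
open import Relation.Binary.PropositionalEquality using (_≡_)
open import Relation.Nullary using (¬_)

Graph : ℕ → ℕ → Set₁
Graph m n = Fin m × Fin n → Fin m × Fin n → Set

KmxKn : (m n : ℕ) → Graph m n
KmxKn m n (x , y) (x' , y') = (¬ x ≡ x') × (¬ y ≡ y')

-- Complete m-partite graph K_{m(n)}: parts are {x} × Fin n, x ∈ Fin m;
-- (x,y) ~ (x',y') iff x ≠ x'.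
Kmn : (m n : ℕ) → Graph m n
Kmn m n (x , y) (x' , y') = ¬ x ≡ x'

vertices : (m n : ℕ) → List (Fin m × Fin n)
vertices m n = cartesianProduct (allFinL m) (allFinL n)

IsColoring : ∀ {m n} → Graph m n → (k : ℕ) → (Fin m × Fin n → Fin k) → Set
IsColoring G k f = ∀ u v → G u v → ¬ f u ≡ f v

classSize : ∀ {m n k} → (Fin m × Fin n → Fin k) → Fin k → ℕ
classSize {m} {n} f i = length (filter (λ v → f v ≟ i) (vertices m n))

IsREquitable : ∀ {m n} → Graph m n → (r k : ℕ) → (Fin m × Fin n → Fin k) → Set
IsREquitable G r k f =
  IsColoring G k f × (∀ i j → classSize f i ≤ classSize f j + r)

REquitablyColorable : ∀ {m n} → Graph m n → (r k : ℕ) → Set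
REquitablyColorable {m} {n} G r k = Σ (Fin m × Fin n → Fin k) (IsREquitable G r k)

⌈_/_⌉ : (a b : ℕ) → .{{_ : NonZero b}} → ℕ
⌈ a / b ⌉ = (a + b ∸ 1) / b

-- If the coloring never repeats a color inside a column, it is already proper on K_{m(n)}.
-- Otherwise one class lies in a single column, so it has at most m vertices and, by
-- r-equitability, every class has at most m + r.  A class of K_m × K_n lies in a row or
-- in a column; let C count the classes meeting two rows and R x those meeting only row x.
-- Row x has n ≤ C + (m + r) R x vertices, while C + Σ R x ≤ k; a row with m R x ≤ Σ R
-- then forces k ≥ min (n ∸ r ⌊n/(m+r)⌋) (m ⌈n/(m+r)⌉).
module Submission where

open import Defs
open import Data.Nat
  using (ℕ; zero; suc; _+_; _*_; _∸_; _≤_; _<_; _⊓_; _/_; NonZero; z≤n; s≤s; s≤s⁻¹; _≤?_)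
open import Data.Nat.Properties hiding (_≟_; suc-injective)
open import Data.Nat.DivMod using (/-monoˡ-≤; m/n≡1+[m∸n]/n)
open import Data.Fin using (Fin; zero; suc; punchIn)
open import Data.Fin.Properties using (_≟_; any?; punchInᵢ≢i; nonZeroIndex)
open import Data.Bool using (true; false; if_then_else_)
open import Data.Product using (∃; ∃₂; _×_; _,_)
open import Data.List using (_++_; map; tabulate; filter; length; cartesianProduct)
open import Data.List.Properties using (length-++; filter-++; map-tabulate)
open import Relation.Unary using (Decidable)
open import Relation.Nullary using (Dec; yes; no; ¬_; does)
open import Relation.Nullary.Decidable using (_×-dec_; ¬?)
open import Relation.Binary.PropositionalEquality
open import Data.Empty using (⊥-elim)
open import Function using (_∘_; id)
open import Algebra.Properties.Semiring.Sum +-*-semiring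
  using (sum; sum-syntax; sum-remove; sum-cong-≗; sum-replicate-zero;
         ∑-comm; ∑-distrib-+; *-distribˡ-sum; *-distribʳ-sum)

∑-mono-≤ : ∀ {n} {f g : Fin n → ℕ} → (∀ i → f i ≤ g i) → sum f ≤ sum g
∑-mono-≤ {zero}  _   = z≤n
∑-mono-≤ {suc n} f≤g = +-mono-≤ (f≤g zero) (∑-mono-≤ (f≤g ∘ suc))

∑-const : ∀ n c → ∑[ i < n ] c ≡ n * c
∑-const zero    c = refl
∑-const (suc n) c = cong (c +_) (∑-const n c)

≤-sum : ∀ {n} (f : Fin n → ℕ) i → f i ≤ sum f
≤-sum {suc n} f i = ≤-trans (m≤m+n (f i) _) (≤-reflexive (sym (sum-remove {i = i} f)))

∃-positive-summand : ∀ {n} (f : Fin n → ℕ) → 0 < sum f → ∃ λ i → 0 < f i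
∃-positive-summand {suc n} f pos with 1 ≤? f zero
... | yes 0<f₀ = zero , 0<f₀
... | no  0≮f₀
  with i , 0<fᵢ ← ∃-positive-summand (f ∘ suc)
                    (subst (λ f₀ → 0 < f₀ + sum (f ∘ suc)) (n<1⇒n≡0 (≰⇒> 0≮f₀)) pos)
  = suc i , 0<fᵢ

∃-below-average : ∀ {n} .{{_ : NonZero n}} (f : Fin n → ℕ) → ∃ λ i → n * f i ≤ sum f
∃-below-average {1}         f = zero , ≤-refl
∃-below-average {suc (suc n)} f with i , avg ← ∃-below-average (f ∘ suc) | f zero ≤? f (suc i)
... | yes f₀≤fᵢ = zero , +-monoʳ-≤ (f zero) (≤-trans (*-monoʳ-≤ (suc n) f₀≤fᵢ) avg)
... | no  f₀≰fᵢ = suc i , +-mono-≤ (<⇒≤ (≰⇒> f₀≰fᵢ)) avg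

nonZeroCount : ∀ {n} → (Fin n → ℕ) → ℕ
nonZeroCount {n} f = ∑[ i < n ] (f i ⊓ 1)

nonZeroCount-punchIn : ∀ {n} (f : Fin (suc n) → ℕ) i →
                       2 ≤ nonZeroCount f → 1 ≤ nonZeroCount (f ∘ punchIn i)
nonZeroCount-punchIn f i two = s≤s⁻¹ (begin
  2                                           ≤⟨ two ⟩
  nonZeroCount f                              ≡⟨ sum-remove {i = i} (λ i → f i ⊓ 1) ⟩
  f i ⊓ 1 + nonZeroCount (f ∘ punchIn i)      ≤⟨ +-monoˡ-≤ _ (m⊓n≤n (f i) 1) ⟩
  1 + nonZeroCount (f ∘ punchIn i)            ∎)
  where open ≤-Reasoning

∃₂-positive-summands : ∀ {n} (f : Fin n → ℕ) → 2 ≤ nonZeroCount f →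
             ∃₂ λ i j → ¬ i ≡ j × 0 < f i × 0 < f j
∃₂-positive-summands {suc n} f two
  with i , 0<fᵢ⊓1 ← ∃-positive-summand (λ i → f i ⊓ 1) (≤-trans (s≤s z≤n) two)
  with j , 0<fⱼ⊓1 ← ∃-positive-summand (λ j → f (punchIn i j) ⊓ 1) (nonZeroCount-punchIn f i two)
  = i , punchIn i j , punchInᵢ≢i i j ∘ sym
  , ≤-trans 0<fᵢ⊓1 (m⊓n≤m _ 1) , ≤-trans 0<fⱼ⊓1 (m⊓n≤m _ 1)

𝟙 : ∀ {P : Set} → Dec P → ℕ
𝟙 P? = if does P? then 1 else 0

𝟙-yes : ∀ {P : Set} (P? : Dec P) → P → 𝟙 P? ≡ 1
𝟙-yes (yes _) _ = refl
𝟙-yes (no ¬p) p = ⊥-elim (¬p p)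

𝟙-positive : ∀ {P : Set} (P? : Dec P) → 0 < 𝟙 P? → P
𝟙-positive (yes p) _ = p

∑-𝟙-≟ : ∀ {n} (j : Fin n) → ∑[ i < n ] 𝟙 (j ≟ i) ≡ 1
∑-𝟙-≟ {suc n} zero    = cong suc (sum-replicate-zero n)
∑-𝟙-≟ {suc n} (suc j) = ∑-𝟙-≟ j

length-filter-tabulate : ∀ {A : Set} {P : A → Set} (P? : Decidable P) {n} (g : Fin n → A) →
                         length (filter P? (tabulate g)) ≡ ∑[ i < n ] 𝟙 (P? (g i))
length-filter-tabulate P? {zero}  g = refl
length-filter-tabulate P? {suc n} g with does (P? (g zero))
... | true  = cong suc (length-filter-tabulate P? (g ∘ suc))
... | false = length-filter-tabulate P? (g ∘ suc)

length-filter-cartesianProduct :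
  ∀ {A B : Set} {P : A × B → Set} (P? : Decidable P) {m n} (g : Fin m → A) (h : Fin n → B) →
  length (filter P? (cartesianProduct (tabulate g) (tabulate h))) ≡
  ∑[ i < m ] ∑[ j < n ] 𝟙 (P? (g i , h j))
length-filter-cartesianProduct P? {zero}  g h = refl
length-filter-cartesianProduct P? {suc m} g h = begin
  length (filter P? (row ++ rows))                ≡⟨ cong length (filter-++ P? row rows) ⟩
  length (filter P? row ++ filter P? rows)        ≡⟨ length-++ (filter P? row) ⟩
  length (filter P? row) + length (filter P? rows)
    ≡⟨ cong₂ _+_ (trans (cong (length ∘ filter P?) (map-tabulate h (g zero ,_)))
                        (length-filter-tabulate P? (λ j → g zero , h j)))
                 (length-filter-cartesianProduct P? (g ∘ suc) h) ⟩
  _ ∎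
  where
  open ≡-Reasoning
  row   = map (g zero ,_) (tabulate h)
  rows  = cartesianProduct (tabulate (g ∘ suc)) (tabulate h)

⌈/⌉≤1+/ : ∀ a b .{{_ : NonZero b}} → ⌈ a / b ⌉ ≤ suc (a / b)
⌈/⌉≤1+/ a b = begin
  (a + b ∸ 1) / b        ≤⟨ /-monoˡ-≤ b (m∸n≤m (a + b) 1) ⟩
  (a + b) / b            ≡⟨ m/n≡1+[m∸n]/n (m≤n+m b a) ⟩
  suc ((a + b ∸ b) / b)  ≡⟨ cong (λ a′ → suc (a′ / b)) (m+n∸n≡m a b) ⟩
  suc (a / b)            ∎
  where open ≤-Reasoning

colorThreshold : (m r n : ℕ) .{{_ : NonZero (m + r)}} → ℕ
colorThreshold m r n = (n ∸ r * (n / (m + r))) ⊓ (m * ⌈ n / (m + r) ⌉)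

colorThreshold≤ : ∀ {m r n k C j} .{{_ : NonZero (m + r)}} →
                  C + m * j ≤ k → n ≤ C + (m + r) * j → colorThreshold m r n ≤ k
colorThreshold≤ {m} {r} {n} {k} {C} {j} colors rows with ⌈ n / (m + r) ⌉ ≤? j
... | yes ⌈n/m+r⌉≤j = begin
  colorThreshold m r n  ≤⟨ m⊓n≤n _ _ ⟩
  m * ⌈ n / (m + r) ⌉   ≤⟨ *-monoʳ-≤ m ⌈n/m+r⌉≤j ⟩
  m * j                 ≤⟨ m≤n+m _ C ⟩
  C + m * j             ≤⟨ colors ⟩
  k                     ∎
  where open ≤-Reasoning
... | no  ⌈n/m+r⌉≰j = ≤-trans (m⊓n≤m _ _) (m≤n+o⇒m∸n≤o n (r * q) (begin
  n                          ≤⟨ rows ⟩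
  C + (m + r) * j            ≡⟨ cong (C +_) (*-distribʳ-+ j m r) ⟩
  C + (m * j + r * j)        ≡⟨ +-assoc C (m * j) (r * j) ⟨
  C + m * j + r * j          ≤⟨ +-mono-≤ colors (*-monoʳ-≤ r j≤q) ⟩
  k + r * q                  ≡⟨ +-comm k (r * q) ⟩
  r * q + k                  ∎))
  where
  open ≤-Reasoning
  q = n / (m + r)
  j≤q : j ≤ q
  j≤q = s≤s⁻¹ (≤-trans (≰⇒> ⌈n/m+r⌉≰j) (⌈/⌉≤1+/ n (m + r)))

𝟙¬+*𝟙≤1 : ∀ {a} (a≤?1 : Dec (a ≤ 1)) → 𝟙 (¬? a≤?1) + a * 𝟙 a≤?1 ≤ 1
𝟙¬+*𝟙≤1 {a} (yes a≤1) rewrite *-identityʳ a = a≤1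
𝟙¬+*𝟙≤1 {a} (no  _)   rewrite *-zeroʳ a = ≤-refl

≤*⊓1 : ∀ {a b} → a ≤ b → a ≤ b * (a ⊓ 1)
≤*⊓1 {zero}  _   = z≤n
≤*⊓1 {suc a} {b} a≤b rewrite ⊓-zeroʳ a | *-identityʳ b = a≤b

module ColoringOfKmxKn {m n k} (f : Fin m × Fin n → Fin k)
                       (proper : IsColoring (KmxKn m n) k f) where

  rowCount : Fin k → Fin m → ℕ
  rowCount c x = ∑[ y < n ] 𝟙 (f (x , y) ≟ c)

  rowsMet : Fin k → ℕ
  rowsMet c = nonZeroCount (rowCount c)

  classSize≡∑rowCount : ∀ c → classSize f c ≡ sum (rowCount c)
  classSize≡∑rowCount c = length-filter-cartesianProduct (λ v → f v ≟ c) id id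

  ∑-rowCount : ∀ x → ∑[ c < k ] rowCount c x ≡ n
  ∑-rowCount x = begin
    ∑[ c < k ] ∑[ y < n ] 𝟙 (f (x , y) ≟ c)  ≡⟨ ∑-comm (λ c y → 𝟙 (f (x , y) ≟ c)) ⟩
    ∑[ y < n ] ∑[ c < k ] 𝟙 (f (x , y) ≟ c)  ≡⟨ sum-cong-≗ (λ y → ∑-𝟙-≟ (f (x , y))) ⟩
    ∑[ y < n ] 1                              ≡⟨ ∑-const n 1 ⟩
    n * 1                                     ≡⟨ *-identityʳ n ⟩
    n                                         ∎
    where open ≡-Reasoning

  rowCount-positive : ∀ c x → 0 < rowCount c x → ∃ λ y → f (x , y) ≡ c
  rowCount-positive c x pos with y , 0<𝟙 ← ∃-positive-summand (λ y → 𝟙 (f (x , y) ≟ c)) pos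
    = y , 𝟙-positive (f (x , y) ≟ c) 0<𝟙

  -- Two vertices of one color never differ in both coordinates, and (x , y) cannot
  -- agree with both x₁ and x₂ in the first one.
  class⊆column : ∀ {c x₁ x₂ y₀} → ¬ x₁ ≡ x₂ → f (x₁ , y₀) ≡ c → f (x₂ , y₀) ≡ c →
                 ∀ {x y} → f (x , y) ≡ c → y ≡ y₀
  class⊆column {c} {x₁} {x₂} {y₀} x₁≢x₂ c₁ c₂ {x} {y} fxy≡c with y ≟ y₀ | x ≟ x₁
  ... | yes y≡y₀ | _        = y≡y₀
  ... | no  y≢y₀ | yes refl = ⊥-elim (proper _ _ (x₁≢x₂ , y≢y₀) (trans fxy≡c (sym c₂)))
  ... | no  y≢y₀ | no  x≢x₁ = ⊥-elim (proper _ _ (x≢x₁ , y≢y₀) (trans fxy≡c (sym c₁)))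

  rowCount≤1 : ∀ {c x₁ x₂ y₀} → ¬ x₁ ≡ x₂ → f (x₁ , y₀) ≡ c → f (x₂ , y₀) ≡ c →
               ∀ x → rowCount c x ≤ 1
  rowCount≤1 {c} {y₀ = y₀} x₁≢x₂ c₁ c₂ x =
    ≤-trans (∑-mono-≤ in-column) (≤-reflexive (∑-𝟙-≟ y₀))
    where
    in-column : ∀ y → 𝟙 (f (x , y) ≟ c) ≤ 𝟙 (y₀ ≟ y)
    in-column y with f (x , y) ≟ c
    ... | no  _     = z≤n
    ... | yes fxy≡c = ≤-reflexive (sym (𝟙-yes (y₀ ≟ y) (sym (class⊆column x₁≢x₂ c₁ c₂ fxy≡c))))

  rowsMet≥2⇒rowCount≤1 : ∀ c → 2 ≤ rowsMet c → ∀ x → rowCount c x ≤ 1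
  rowsMet≥2⇒rowCount≤1 c two
    with x₁ , x₂ , x₁≢x₂ , pos₁ , pos₂ ← ∃₂-positive-summands (rowCount c) two
    with y₁ , c₁ ← rowCount-positive c x₁ pos₁
       | y₂ , c₂ ← rowCount-positive c x₂ pos₂
    with y₁ ≟ y₂
  ... | yes refl = rowCount≤1 x₁≢x₂ c₁ c₂
  ... | no  y₁≢y₂ = ⊥-elim (proper _ _ (x₁≢x₂ , y₁≢y₂) (trans c₁ (sym c₂)))

  single? : ∀ c → Dec (rowsMet c ≤ 1)
  single? c = rowsMet c ≤? 1

  multiRowColors : ℕ
  multiRowColors = ∑[ c < k ] 𝟙 (¬? (single? c))

  singleRowColorsIn : Fin m → ℕ
  singleRowColorsIn x = ∑[ c < k ] ((rowCount c x ⊓ 1) * 𝟙 (single? c))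

  color-budget : multiRowColors + sum singleRowColorsIn ≤ k
  color-budget = begin
    multiRowColors + ∑[ x < m ] ∑[ c < k ] ((rowCount c x ⊓ 1) * 𝟙 (single? c))
      ≡⟨ cong (multiRowColors +_) (∑-comm (λ x c → (rowCount c x ⊓ 1) * 𝟙 (single? c))) ⟩
    multiRowColors + ∑[ c < k ] ∑[ x < m ] ((rowCount c x ⊓ 1) * 𝟙 (single? c))
      ≡⟨ cong (multiRowColors +_)
              (sum-cong-≗ (λ c → *-distribʳ-sum (𝟙 (single? c)) (λ x → rowCount c x ⊓ 1))) ⟨
    multiRowColors + ∑[ c < k ] (rowsMet c * 𝟙 (single? c))
      ≡⟨ ∑-distrib-+ (λ c → 𝟙 (¬? (single? c))) (λ c → rowsMet c * 𝟙 (single? c)) ⟨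
    ∑[ c < k ] (𝟙 (¬? (single? c)) + rowsMet c * 𝟙 (single? c))
      ≤⟨ ∑-mono-≤ (λ c → 𝟙¬+*𝟙≤1 (single? c)) ⟩
    ∑[ c < k ] 1
      ≡⟨ ∑-const k 1 ⟩
    k * 1
      ≡⟨ *-identityʳ k ⟩
    k ∎
    where open ≤-Reasoning

  -- A color meeting two rows adds at most 1 to each row; one meeting a single row adds
  -- at most b to it.
  row-budget : ∀ {b} → (∀ c x → rowCount c x ≤ b) →
               ∀ x → n ≤ multiRowColors + b * singleRowColorsIn x
  row-budget {b} rowCount≤b x = begin
    n
      ≡⟨ ∑-rowCount x ⟨
    ∑[ c < k ] rowCount c x
      ≤⟨ ∑-mono-≤ (λ c → split c (single? c)) ⟩
    ∑[ c < k ] (𝟙 (¬? (single? c)) + b * ((rowCount c x ⊓ 1) * 𝟙 (single? c)))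
      ≡⟨ ∑-distrib-+ (λ c → 𝟙 (¬? (single? c))) _ ⟩
    multiRowColors + ∑[ c < k ] (b * ((rowCount c x ⊓ 1) * 𝟙 (single? c)))
      ≡⟨ cong (multiRowColors +_)
              (*-distribˡ-sum b (λ c → (rowCount c x ⊓ 1) * 𝟙 (single? c))) ⟨
    multiRowColors + b * singleRowColorsIn x
      ∎
    where
    open ≤-Reasoning
    split : ∀ c (s? : Dec (rowsMet c ≤ 1)) →
            rowCount c x ≤ 𝟙 (¬? s?) + b * ((rowCount c x ⊓ 1) * 𝟙 s?)
    split c (yes _) rewrite *-identityʳ (rowCount c x ⊓ 1) = ≤*⊓1 (rowCount≤b c x)
    split c (no  rowsMet≰1) = ≤-trans (rowsMet≥2⇒rowCount≤1 c (≰⇒> rowsMet≰1) x) (m≤m+n 1 _)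

  colorThreshold≤k : ∀ {r} .{{_ : NonZero (m + r)}} →
                     (∀ i j → classSize f i ≤ classSize f j + r) →
                     ∀ {x₁ x₂ y₀} → ¬ x₁ ≡ x₂ → f (x₁ , y₀) ≡ f (x₂ , y₀) →
                     colorThreshold m r n ≤ k
  colorThreshold≤k {r} equitable {x₁} {x₂} {y₀} x₁≢x₂ repeat
    with x₀ , average ← ∃-below-average {{nonZeroIndex x₁}} singleRowColorsIn
    = colorThreshold≤ {m} {r} {n} {k} {multiRowColors} {singleRowColorsIn x₀}
                      (≤-trans (+-monoʳ-≤ multiRowColors average) color-budget)
                      (row-budget rowCount≤m+r x₀)
    where
    open ≤-Reasoning
    c₀ = f (x₁ , y₀)

    classSize-c₀≤m : classSize f c₀ ≤ m
    classSize-c₀≤m = begin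
      classSize f c₀    ≡⟨ classSize≡∑rowCount c₀ ⟩
      sum (rowCount c₀) ≤⟨ ∑-mono-≤ (rowCount≤1 x₁≢x₂ refl (sym repeat)) ⟩
      ∑[ x < m ] 1      ≡⟨ ∑-const m 1 ⟩
      m * 1             ≡⟨ *-identityʳ m ⟩
      m                 ∎

    rowCount≤m+r : ∀ c x → rowCount c x ≤ m + r
    rowCount≤m+r c x = begin
      rowCount c x       ≤⟨ ≤-sum (rowCount c) x ⟩
      sum (rowCount c)   ≡⟨ classSize≡∑rowCount c ⟨
      classSize f c      ≤⟨ equitable c c₀ ⟩
      classSize f c₀ + r ≤⟨ +-monoˡ-≤ r classSize-c₀≤m ⟩
      m + r              ∎

IsColoring-Kmn : ∀ {m n k} {f : Fin m × Fin n → Fin k} →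
                 (∀ {x₁ x₂ y} → ¬ x₁ ≡ x₂ → ¬ f (x₁ , y) ≡ f (x₂ , y)) →
                 IsColoring (KmxKn m n) k f → IsColoring (Kmn m n) k f
IsColoring-Kmn columns-rainbow proper (x , y) (x′ , y′) x≢x′ with y ≟ y′
... | yes refl = columns-rainbow x≢x′
... | no  y≢y′ = proper (x , y) (x′ , y′) (x≢x′ , y≢y′)

lemma14 : (m s θ n r k : ℕ) → 2 ≤ m → 1 ≤ s → 1 ≤ θ → 1 ≤ n → 1 ≤ r → 1 ≤ k →
    .{{_ : NonZero (m + r)}} →
    k < (n ∸ r * (n / (m + r))) ⊓ (m * ⌈ n / (m + r) ⌉) →
    REquitablyColorable (KmxKn m n) r k →
    REquitablyColorable (Kmn m n) r k
lemma14 m s θ n r k _ _ _ _ _ _ k<threshold (f , proper , equitable)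
  with any? (λ x₁ → any? (λ x₂ → any? (λ y → ¬? (x₁ ≟ x₂) ×-dec (f (x₁ , y) ≟ f (x₂ , y)))))
... | yes (x₁ , x₂ , y , x₁≢x₂ , repeat) =
  ⊥-elim (<⇒≱ k<threshold (ColoringOfKmxKn.colorThreshold≤k f proper equitable x₁≢x₂ repeat))
... | no  no-repeat =
  f , IsColoring-Kmn (λ x₁≢x₂ repeat → no-repeat (_ , _ , _ , x₁≢x₂ , repeat)) proper , equitable
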